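{- Let $G$ be a connected $r$-regular graph with $n$ vertices. Then $$C(G)\le \frac{nr(r-1)}{4}.$$
   Context: All graphs are finite and simple. For a connected graph $G$, regard each edge as a unit resistor. $\Omega_G(i,j)$ is the effective resistance between $i$ and $j$. The global cyclicity index is $$C(G)=\sum_{ij\in E(G)}\Big[\frac{1}{\Omega_G(i,j)}-1\Big].$$ -}

module Defs where

open import Data.Nat as ℕ using (ℕ; zero; suc)
open import Data.Integer using (+_)
open import Data.Fin using (Fin; zero; suc; toℕ)
open import Data.Fin.Properties using () renaming (_≟_ to _≟ᶠ_)
open import Data.Bool using (Bool; true; false; if_then_else_; _∧_)
open import Data.Rational using (ℚ; 0ℚ; 1ℚ; _+_; _-_; _*_; 1/_; _≤_; _/_; ≢-nonZero)
open import Data.Rational.Properties using (_≟_)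
open import Data.Product using (Σ; _×_; ∃)
open import Relation.Nullary using (¬_; yes; no; does)
open import Relation.Binary.PropositionalEquality using (_≡_)

record Graph (n : ℕ) : Set where
  field
    adj   : Fin n → Fin n → Bool
    sym   : ∀ i j → adj i j ≡ adj j i
    irrefl : ∀ i → adj i i ≡ false
open Graph public

sumFinℕ : ∀ {n} → (Fin n → ℕ) → ℕ
sumFinℕ {zero}  f = 0
sumFinℕ {suc n} f = f zero ℕ.+ sumFinℕ (λ i → f (suc i))

sumFin : ∀ {n} → (Fin n → ℚ) → ℚ
sumFin {zero}  f = 0ℚ
sumFin {suc n} f = f zero + sumFin (λ i → f (suc i))

degree : ∀ {n} → Graph n → Fin n → ℕ
degree G i = sumFinℕ (λ j → if adj G i j then 1 else 0)

Regular : ∀ {n} → Graph n → ℕ → Set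
Regular G r = ∀ i → degree G i ≡ r

data Walk {n} (G : Graph n) : Fin n → Fin n → Set where
  here : ∀ {i} → Walk G i i
  step : ∀ {i j k} → adj G i j ≡ true → Walk G j k → Walk G i k

Connected : ∀ {n} → Graph n → Set
Connected G = ∀ i j → Walk G i j

laplacian : ∀ {n} → Graph n → (Fin n → ℚ) → Fin n → ℚ
laplacian G x i = sumFin (λ j → if adj G i j then x i - x j else 0ℚ)

unitVec : ∀ {n} → Fin n → Fin n → ℚ
unitVec i k = if does (k ≟ᶠ i) then 1ℚ else 0ℚ

-- Effective resistance (unit resistors): ω is the potential difference
-- x_i - x_j for a potential x satisfying Kirchhoff's equations L x = e_i - e_j
-- (unit current entering at i, leaving at j).  For connected graphs such x
-- exists and x_i - x_j is uniquely determined.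
IsEffRes : ∀ {n} → Graph n → Fin n → Fin n → ℚ → Set
IsEffRes {n} G i j ω =
  Σ (Fin n → ℚ) λ x →
    (∀ k → laplacian G x k ≡ unitVec i k - unitVec j k) × (ω ≡ x i - x j)

-- reciprocal, total (1/0 := 0; only applied to edge resistances, which are > 0)
inv : ℚ → ℚ
inv q with q ≟ 0ℚ
... | yes _ = 0ℚ
... | no q≢0 = 1/_ q {{≢-nonZero q≢0}}

cyclicity : ∀ {n} → Graph n → (Fin n → Fin n → ℚ) → ℚ
cyclicity G Ω =
  sumFin (λ i → sumFin (λ j →
    if adj G i j ∧ (toℕ i ℕ.<ᵇ toℕ j) then inv (Ω i j) - 1ℚ else 0ℚ))

-- For an edge ij of an r-regular graph let x be a potential with L x = e_i − e_j, so that
-- ω = x_i − x_j = Ω(i,j), and put y = e_i − e_j and s = r + 1.  For the Dirichlet form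
-- D(a,b) = Σ_{u~v} (a_u − a_v)(b_u − b_v) = 2⟨a, L b⟩, summed over ordered pairs, one finds
-- D(x,x) = 2ω, D(x,y) = 4 and D(y,y) = 2((L y)_i − (L y)_j) = 4s, hence
-- 0 ≤ D(s x − y, s x − y) = 2s(sω − 2), i.e. Ω(i,j) ≥ 2/(r+1).  Every edge thus contributes
-- at most (r − 1)/2 to C(G), and by the handshake lemma there are nr/2 edges.
module Submission where

open import Algebra.Bundles using (CommutativeRing)
open import Data.Bool using (Bool; true; false; if_then_else_; _∧_)
open import Data.Empty using (⊥-elim)
open import Data.Fin using (Fin; zero; suc; toℕ)
open import Data.Fin.Properties using (toℕ-injective) renaming (_≟_ to _≟ᶠ_)
import Data.Integer as ℤ
import Data.Integer.Tactic.RingSolver as ℤ-Solver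
open import Data.Nat as ℕ using (ℕ; zero; suc; _∸_)
import Data.Nat.Properties as ℕ
open import Data.Product using (_,_)
open import Data.Rational
open import Data.Rational.Properties
import Data.Rational.Unnormalised as ℚᵘ
import Data.Rational.Unnormalised.Properties as ℚᵘ
open import Data.Sum using (inj₁; inj₂)
open import Data.Unit using (tt)
open import Defs hiding (sym)
open import Function using (_∘_)
open import Level using (0ℓ)
open import Relation.Binary.PropositionalEquality
open import Relation.Nullary.Decidable using (yes; no; dec⇒maybe; dec-true; dec-false)
open import Relation.Nullary.Reflects using (ofʸ; ofⁿ)
open import Tactic.RingSolver using (solve-∀)
import Tactic.RingSolver.Core.AlmostCommutativeRing as ACR

open import Algebra.Properties.CommutativeMonoid.Sum +-0-commutativeMonoid
  using (sum; sum-syntax; ∑-distrib-+; ∑-comm; sum-cong-≗; sum-replicate; sum-replicate-zero)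
open import Algebra.Properties.Semiring.Sum (CommutativeRing.semiring +-*-commutativeRing)
  using (*-distribˡ-sum; *-distribʳ-sum)
open import Algebra.Properties.Semiring.Mult (CommutativeRing.semiring +-*-commutativeRing)
  using (_×_; ×-homo-1; ×-homo-+; ×-assocˡ; ×1-homo-*)

ℚ-ring : ACR.AlmostCommutativeRing 0ℓ 0ℓ
ℚ-ring = ACR.fromCommutativeRing +-*-commutativeRing (λ q → dec⇒maybe (0ℚ ≟ q))

*-nonNeg : ∀ {p q} → 0ℚ ≤ p → 0ℚ ≤ q → 0ℚ ≤ p * q
*-nonNeg {p} {q} 0≤p 0≤q =
  nonNegative⁻¹ (p * q) {{nonNeg*nonNeg⇒nonNeg p {{nonNegative 0≤p}} q {{nonNegative 0≤q}}}}

square-nonNeg : ∀ p → 0ℚ ≤ p * p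
square-nonNeg p with ≤-total 0ℚ p
... | inj₁ 0≤p = *-nonNeg 0≤p 0≤p
... | inj₂ p≤0 = nonNegative⁻¹ (p * p) {{nonPos*nonPos⇒nonPos p {{nonPositive p≤0}} p {{nonPositive p≤0}}}}

≤*⇒pos : ∀ {s c ω} → 0ℚ ≤ s → 0ℚ < c → c ≤ s * ω → Positive ω
≤*⇒pos {s} {c} {ω} 0≤s 0<c c≤sω with 0ℚ <? ω
... | yes 0<ω = positive 0<ω
... | no  0≮ω = ⊥-elim (<-irrefl refl (<-≤-trans 0<c (≤-trans c≤sω sω≤0)))
  where
  sω≤0 : s * ω ≤ 0ℚ
  sω≤0 = subst (s * ω ≤_) (*-zeroʳ s) (*-monoˡ-≤-nonNeg s {{nonNegative 0≤s}} (≮⇒≥ 0≮ω))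

inv-pos : ∀ ω .{{_ : Positive ω}} → inv ω ≡ (1/ ω) {{pos⇒nonZero ω}}
inv-pos ω with ω ≟ 0ℚ
... | yes refl = ⊥-elim (<-irrefl refl (positive⁻¹ 0ℚ))
... | no _     = refl

fromℕ : ℕ → ℚ
fromℕ k = k × 1ℚ

fromℕ-nonNeg : ∀ k → 0ℚ ≤ fromℕ k
fromℕ-nonNeg zero    = ≤-refl
fromℕ-nonNeg (suc k) = +-mono-≤ {0ℚ} {1ℚ} (≤ᵇ⇒≤ tt) (fromℕ-nonNeg k)

toℚᵘ-fromℕ : ∀ k → toℚᵘ (fromℕ k) ℚᵘ.≃ ℚᵘ.mkℚᵘ (ℤ.+ k) 0
toℚᵘ-fromℕ zero    = ℚᵘ.≃-refl
toℚᵘ-fromℕ (suc k) = begin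
  toℚᵘ (1ℚ + fromℕ k)            ≈⟨ toℚᵘ-homo-+ 1ℚ (fromℕ k) ⟩
  ℚᵘ.1ℚᵘ ℚᵘ.+ toℚᵘ (fromℕ k)     ≈⟨ ℚᵘ.+-congʳ ℚᵘ.1ℚᵘ (toℚᵘ-fromℕ k) ⟩
  ℚᵘ.1ℚᵘ ℚᵘ.+ ℚᵘ.mkℚᵘ (ℤ.+ k) 0  ≈⟨ ℚᵘ.*≡* (cross (ℤ.+ k)) ⟩
  ℚᵘ.mkℚᵘ (ℤ.+ suc k) 0          ∎
  where
  open ℚᵘ.≃-Reasoning
  cross : ∀ m → (ℤ.+ 1 ℤ.* ℤ.+ 1 ℤ.+ m ℤ.* ℤ.+ 1) ℤ.* ℤ.+ 1 ≡ (ℤ.+ 1 ℤ.+ m) ℤ.* (ℤ.+ 1 ℤ.* ℤ.+ 1)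
  cross = ℤ-Solver.solve-∀

/4≡fromℕ*¼ : ∀ k → ℤ.+ k / 4 ≡ fromℕ k * (ℤ.+ 1 / 4)
/4≡fromℕ*¼ k = toℚᵘ-injective (begin
  toℚᵘ (ℤ.+ k / 4)                         ≈⟨ toℚᵘ-fromℚᵘ (ℚᵘ.mkℚᵘ (ℤ.+ k) 3) ⟩
  ℚᵘ.mkℚᵘ (ℤ.+ k) 3                        ≈⟨ ℚᵘ.*≡* (cross (ℤ.+ k)) ⟩
  ℚᵘ.mkℚᵘ (ℤ.+ k) 0 ℚᵘ.* toℚᵘ (ℤ.+ 1 / 4)  ≈⟨ ℚᵘ.*-congʳ (toℚᵘ-fromℕ k) ⟨
  toℚᵘ (fromℕ k) ℚᵘ.* toℚᵘ (ℤ.+ 1 / 4)     ≈⟨ toℚᵘ-homo-* (fromℕ k) (ℤ.+ 1 / 4) ⟨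
  toℚᵘ (fromℕ k * (ℤ.+ 1 / 4))             ∎)
  where
  open ℚᵘ.≃-Reasoning
  cross : ∀ m → m ℤ.* (ℤ.+ 1 ℤ.* ℤ.+ 4) ≡ (m ℤ.* ℤ.+ 1) ℤ.* ℤ.+ 4
  cross = ℤ-Solver.solve-∀

½[1+r]-1≤½[r∸1] : ∀ r → (1ℚ + fromℕ r) * ½ - 1ℚ ≤ fromℕ (r ∸ 1) * ½
½[1+r]-1≤½[r∸1] zero    = ≤ᵇ⇒≤ tt
½[1+r]-1≤½[r∸1] (suc r) = ≤-reflexive (arith (fromℕ r))
  where
  arith : ∀ ρ → (1ℚ + (1ℚ + ρ)) * ½ - 1ℚ ≡ ρ * ½
  arith = solve-∀ ℚ-ring

inv-1≤½[r∸1] : ∀ r ω → 1ℚ + 1ℚ ≤ (1ℚ + fromℕ r) * ω → inv ω - 1ℚ ≤ fromℕ (r ∸ 1) * ½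
inv-1≤½[r∸1] r ω 2≤sω = begin
  inv ω - 1ℚ         ≡⟨ cong (_- 1ℚ) (inv-pos ω) ⟩
  1/ ω - 1ℚ          ≤⟨ +-monoˡ-≤ (- 1ℚ) 1/ω≤½s ⟩
  s * ½ - 1ℚ         ≤⟨ ½[1+r]-1≤½[r∸1] r ⟩
  fromℕ (r ∸ 1) * ½  ∎
  where
  open ≤-Reasoning
  s : ℚ
  s = 1ℚ + fromℕ r
  instance
    ω-pos : Positive ω
    ω-pos = ≤*⇒pos (+-mono-≤ {0ℚ} {1ℚ} (≤ᵇ⇒≤ tt) (fromℕ-nonNeg r))
                   (*<* (ℤ.+<+ (ℕ.s≤s ℕ.z≤n))) 2≤sω
    ω-nonZero : NonZero ω
    ω-nonZero = pos⇒nonZero ω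
  ½/ω-nonNeg : NonNegative (1/ ω * ½)
  ½/ω-nonNeg = nonNegative (*-nonNeg (<⇒≤ (positive⁻¹ (1/ ω) {{1/pos⇒pos ω}})) (≤ᵇ⇒≤ tt))
  1/ω≤½s : 1/ ω ≤ s * ½
  1/ω≤½s = begin
    1/ ω                    ≡⟨ double-half (1/ ω) ⟩
    (1ℚ + 1ℚ) * (1/ ω * ½)  ≤⟨ *-monoʳ-≤-nonNeg (1/ ω * ½) {{½/ω-nonNeg}} 2≤sω ⟩
    s * ω * (1/ ω * ½)      ≡⟨ regroup s ω (1/ ω) ⟩
    s * ½ * (ω * 1/ ω)      ≡⟨ cong (s * ½ *_) (*-inverseʳ ω) ⟩
    s * ½ * 1ℚ              ≡⟨ *-identityʳ (s * ½) ⟩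
    s * ½                   ∎
    where
    double-half : ∀ p → p ≡ (1ℚ + 1ℚ) * (p * ½)
    double-half = solve-∀ ℚ-ring
    regroup : ∀ s ω p → s * ω * (p * ½) ≡ s * ½ * (ω * p)
    regroup = solve-∀ ℚ-ring

𝟙 : Bool → ℚ
𝟙 b = if b then 1ℚ else 0ℚ

𝟙-nonNeg : ∀ b → 0ℚ ≤ 𝟙 b
𝟙-nonNeg true  = ≤ᵇ⇒≤ tt
𝟙-nonNeg false = ≤-refl

if-then-0≡𝟙* : ∀ b q → (if b then q else 0ℚ) ≡ 𝟙 b * q
if-then-0≡𝟙* true  q = sym (*-identityˡ q)
if-then-0≡𝟙* false q = sym (*-zeroˡ q)

fromℕ-indicator : ∀ b → fromℕ (if b then 1 else 0) ≡ 𝟙 b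
fromℕ-indicator true  = ×-homo-1 1ℚ
fromℕ-indicator false = refl

𝟙-<ᵇ-total : ∀ {m n} → m ≢ n → 𝟙 (m ℕ.<ᵇ n) + 𝟙 (n ℕ.<ᵇ m) ≡ 1ℚ
𝟙-<ᵇ-total {m} {n} m≢n with m ℕ.<ᵇ n | ℕ.<ᵇ-reflects-< m n | n ℕ.<ᵇ m | ℕ.<ᵇ-reflects-< n m
... | true  | ofʸ m<n | true  | ofʸ n<m = ⊥-elim (ℕ.<-asym m<n n<m)
... | true  | _       | false | _       = refl
... | false | _       | true  | _       = refl
... | false | ofⁿ m≮n | false | ofⁿ n≮m = ⊥-elim (m≢n (ℕ.≤-antisym (ℕ.≮⇒≥ n≮m) (ℕ.≮⇒≥ m≮n)))

sumFin≡sum : ∀ {n} (f : Fin n → ℚ) → sumFin f ≡ sum f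
sumFin≡sum {zero}  f = refl
sumFin≡sum {suc n} f = cong (f zero +_) (sumFin≡sum (f ∘ suc))

fromℕ-sumFinℕ : ∀ {n} (f : Fin n → ℕ) → fromℕ (sumFinℕ f) ≡ ∑[ i < n ] (fromℕ (f i))
fromℕ-sumFinℕ {zero}  f = refl
fromℕ-sumFinℕ {suc n} f =
  trans (×-homo-+ 1ℚ (f zero) (sumFinℕ (f ∘ suc))) (cong (fromℕ (f zero) +_) (fromℕ-sumFinℕ (f ∘ suc)))

sum-mono-≤ : ∀ {n} {f g : Fin n → ℚ} → (∀ i → f i ≤ g i) → sum f ≤ sum g
sum-mono-≤ {zero}  _   = ≤-refl
sum-mono-≤ {suc n} f≤g = +-mono-≤ (f≤g zero) (sum-mono-≤ (f≤g ∘ suc))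

sum-nonNeg : ∀ {n} {f : Fin n → ℚ} → (∀ i → 0ℚ ≤ f i) → 0ℚ ≤ sum f
sum-nonNeg {n} {f} 0≤f = subst (_≤ sum f) (sum-replicate-zero n) (sum-mono-≤ 0≤f)

sum-neg : ∀ {n} (f : Fin n → ℚ) → sum (λ i → - f i) ≡ - sum f
sum-neg {zero}  f = refl
sum-neg {suc n} f = trans (cong (- f zero +_) (sum-neg (f ∘ suc))) (sym (neg-distrib-+ (f zero) _))

sum-sub : ∀ {n} (f g : Fin n → ℚ) → sum (λ i → f i - g i) ≡ sum f - sum g
sum-sub f g = trans (∑-distrib-+ f (λ i → - g i)) (cong (sum f +_) (sum-neg g))

sum-lincomb : ∀ {n} α β (f g h : Fin n → ℚ) →
  ∑[ i < n ] (α * f i - β * g i + h i) ≡ α * sum f - β * sum g + sum h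
sum-lincomb {n} α β f g h = begin
  ∑[ i < n ] (α * f i - β * g i + h i)
    ≡⟨ ∑-distrib-+ (λ i → α * f i - β * g i) h ⟩
  ∑[ i < n ] (α * f i - β * g i) + sum h
    ≡⟨ cong (_+ sum h) (sum-sub (λ i → α * f i) (λ i → β * g i)) ⟩
  ∑[ i < n ] (α * f i) - ∑[ i < n ] (β * g i) + sum h
    ≡⟨ cong (_+ sum h) (cong₂ _-_ (*-distribˡ-sum α f) (*-distribˡ-sum β g)) ⟨
  α * sum f - β * sum g + sum h ∎
  where open ≡-Reasoning

⟨_,_⟩ : ∀ {n} → (Fin n → ℚ) → (Fin n → ℚ) → ℚ
⟨ a , b ⟩ = sum (λ k → a k * b k)

⟨⟩-comm : ∀ {n} (a b : Fin n → ℚ) → ⟨ a , b ⟩ ≡ ⟨ b , a ⟩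
⟨⟩-comm a b = sum-cong-≗ (λ k → *-comm (a k) (b k))

unitVec-diag : ∀ {n} (i : Fin n) → unitVec i i ≡ 1ℚ
unitVec-diag i = cong 𝟙 (dec-true (i ≟ᶠ i) refl)

unitVec-offDiag : ∀ {n} {i k : Fin n} → k ≢ i → unitVec i k ≡ 0ℚ
unitVec-offDiag {i = i} {k} k≢i = cong 𝟙 (dec-false (k ≟ᶠ i) k≢i)

⟨⟩-unitVec : ∀ {n} (a : Fin n → ℚ) (i : Fin n) → ⟨ a , unitVec i ⟩ ≡ a i
⟨⟩-unitVec {suc n} a zero = begin
  a zero * 1ℚ + ∑[ k < n ] (a (suc k) * 0ℚ)
    ≡⟨ cong₂ _+_ (*-identityʳ (a zero)) (sum-cong-≗ (λ k → *-zeroʳ (a (suc k)))) ⟩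
  a zero + ∑[ k < n ] 0ℚ
    ≡⟨ cong (a zero +_) (sum-replicate-zero n) ⟩
  a zero + 0ℚ
    ≡⟨ +-identityʳ (a zero) ⟩
  a zero ∎
  where open ≡-Reasoning
⟨⟩-unitVec a (suc i) = trans (cong (_+ ⟨ a ∘ suc , unitVec i ⟩) (*-zeroʳ (a zero)))
                             (trans (+-identityˡ _) (⟨⟩-unitVec (a ∘ suc) i))

dipole : ∀ {n} → Fin n → Fin n → Fin n → ℚ
dipole i j k = unitVec i k - unitVec j k

⟨⟩-dipole : ∀ {n} (a : Fin n → ℚ) (i j : Fin n) → ⟨ a , dipole i j ⟩ ≡ a i - a j
⟨⟩-dipole a i j = begin
  ⟨ a , dipole i j ⟩
    ≡⟨ sum-cong-≗ (λ k → distrib (a k) (unitVec i k) (unitVec j k)) ⟩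
  sum (λ k → a k * unitVec i k - a k * unitVec j k)
    ≡⟨ sum-sub (λ k → a k * unitVec i k) (λ k → a k * unitVec j k) ⟩
  ⟨ a , unitVec i ⟩ - ⟨ a , unitVec j ⟩
    ≡⟨ cong₂ _-_ (⟨⟩-unitVec a i) (⟨⟩-unitVec a j) ⟩
  a i - a j ∎
  where
  open ≡-Reasoning
  distrib : ∀ a x y → a * (x - y) ≡ a * x - a * y
  distrib = solve-∀ ℚ-ring

module _ {n} (G : Graph n) where

  weight : Fin n → Fin n → ℚ
  weight u v = 𝟙 (adj G u v)

  laplacian-weight : ∀ a u → laplacian G a u ≡ ∑[ v < n ] (weight u v * (a u - a v))
  laplacian-weight a u = trans (sumFin≡sum (λ v → if adj G u v then a u - a v else 0ℚ))
                               (sum-cong-≗ (λ v → if-then-0≡𝟙* (adj G u v) (a u - a v)))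

  ∑weight≡degree : ∀ u → ∑[ v < n ] (weight u v) ≡ fromℕ (degree G u)
  ∑weight≡degree u = sym (trans (fromℕ-sumFinℕ (λ v → if adj G u v then 1 else 0))
                                (sum-cong-≗ (λ v → fromℕ-indicator (adj G u v))))

  ∑degree-regular : ∀ {r} → Regular G r → ∑[ u < n ] (fromℕ (degree G u)) ≡ fromℕ (n ℕ.* r)
  ∑degree-regular {r} regular =
    trans (sum-cong-≗ (λ u → cong fromℕ (regular u))) (trans (sum-replicate n) (×-assocˡ 1ℚ n r))

  laplacian-degree : ∀ a u → laplacian G a u ≡ fromℕ (degree G u) * a u - ⟨ weight u , a ⟩
  laplacian-degree a u = begin
    laplacian G a u
      ≡⟨ laplacian-weight a u ⟩
    ∑[ v < n ] (weight u v * (a u - a v))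
      ≡⟨ sum-cong-≗ (λ v → expand (weight u v) (a u) (a v)) ⟩
    ∑[ v < n ] (a u * weight u v - weight u v * a v)
      ≡⟨ sum-sub (λ v → a u * weight u v) (λ v → weight u v * a v) ⟩
    ∑[ v < n ] (a u * weight u v) - ⟨ weight u , a ⟩
      ≡⟨ cong (_- ⟨ weight u , a ⟩) (*-distribˡ-sum (a u) (weight u)) ⟨
    a u * ∑[ v < n ] (weight u v) - ⟨ weight u , a ⟩
      ≡⟨ cong (λ t → a u * t - ⟨ weight u , a ⟩) (∑weight≡degree u) ⟩
    a u * fromℕ (degree G u) - ⟨ weight u , a ⟩
      ≡⟨ cong (_- ⟨ weight u , a ⟩) (*-comm (a u) _) ⟩
    fromℕ (degree G u) * a u - ⟨ weight u , a ⟩ ∎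
    where
    open ≡-Reasoning
    expand : ∀ w p q → w * (p - q) ≡ p * w - w * q
    expand = solve-∀ ℚ-ring

  ⟨⟩-laplacian-potential : ∀ {i j} x → (∀ k → laplacian G x k ≡ dipole i j k) →
                           ∀ a → ⟨ a , laplacian G x ⟩ ≡ a i - a j
  ⟨⟩-laplacian-potential {i} {j} x Lx≡dipole a =
    trans (sum-cong-≗ (λ k → cong (a k *_) (Lx≡dipole k))) (⟨⟩-dipole a i j)

  dirichlet : (Fin n → ℚ) → (Fin n → ℚ) → ℚ
  dirichlet a b = ∑[ u < n ] ∑[ v < n ] (weight u v * ((a u - a v) * (b u - b v)))

  dirichlet-nonNeg : ∀ a → 0ℚ ≤ dirichlet a a
  dirichlet-nonNeg a =
    sum-nonNeg (λ u → sum-nonNeg (λ v → *-nonNeg (𝟙-nonNeg (adj G u v)) (square-nonNeg (a u - a v))))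

  dirichlet-comm : ∀ a b → dirichlet a b ≡ dirichlet b a
  dirichlet-comm a b =
    sum-cong-≗ (λ u → sum-cong-≗ (λ v → cong (weight u v *_) (*-comm (a u - a v) (b u - b v))))

  dirichlet-laplacian : ∀ a b → dirichlet a b ≡ ⟨ a , laplacian G b ⟩ + ⟨ a , laplacian G b ⟩
  dirichlet-laplacian a b = begin
    dirichlet a b                                  ≡⟨ sum-cong-≗ (λ u → sum-cong-≗ (split u)) ⟩
    ∑[ u < n ] ∑[ v < n ] (P u v + P v u)          ≡⟨ sum-cong-≗ (λ u → ∑-distrib-+ (P u) (λ v → P v u)) ⟩
    ∑[ u < n ] (sum (P u) + ∑[ v < n ] (P v u))    ≡⟨ ∑-distrib-+ (sum ∘ P) (λ u → ∑[ v < n ] (P v u)) ⟩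
    ∑P + ∑[ u < n ] ∑[ v < n ] (P v u)             ≡⟨ cong (∑P +_) (∑-comm (λ u v → P v u)) ⟩
    ∑P + ∑P                                        ≡⟨ cong₂ _+_ ∑P≡⟨a,Lb⟩ ∑P≡⟨a,Lb⟩ ⟩
    ⟨ a , laplacian G b ⟩ + ⟨ a , laplacian G b ⟩  ∎
    where
    open ≡-Reasoning
    P : Fin n → Fin n → ℚ
    P u v = a u * (weight u v * (b u - b v))
    ∑P : ℚ
    ∑P = ∑[ u < n ] ∑[ v < n ] (P u v)
    symmetrise : ∀ w au av bu bv → w * ((au - av) * (bu - bv)) ≡ au * (w * (bu - bv)) + av * (w * (bv - bu))
    symmetrise = solve-∀ ℚ-ring
    split : ∀ u v → weight u v * ((a u - a v) * (b u - b v)) ≡ P u v + P v u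
    split u v = trans (symmetrise (weight u v) (a u) (a v) (b u) (b v))
                      (cong (λ w → P u v + a v * (w * (b v - b u))) (cong 𝟙 (Graph.sym G u v)))
    ∑P≡⟨a,Lb⟩ : ∑P ≡ ⟨ a , laplacian G b ⟩
    ∑P≡⟨a,Lb⟩ = sum-cong-≗ (λ u → trans (sym (*-distribˡ-sum (a u) (λ v → weight u v * (b u - b v))))
                                        (cong (a u *_) (sym (laplacian-weight b u))))

  dirichlet-expand : ∀ s x y →
    dirichlet (λ u → s * x u - y u) (λ u → s * x u - y u) ≡
    s * s * dirichlet x x - (s + s) * dirichlet x y + dirichlet y y
  dirichlet-expand s x y =
    trans (sum-cong-≗ (λ u → trans (sum-cong-≗ (λ v → pointwise s (weight u v) (x u) (x v) (y u) (y v)))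
                                   (sum-lincomb (s * s) (s + s) (Q x x u) (Q x y u) (Q y y u))))
          (sum-lincomb (s * s) (s + s) (sum ∘ Q x x) (sum ∘ Q x y) (sum ∘ Q y y))
    where
    Q : (Fin n → ℚ) → (Fin n → ℚ) → Fin n → Fin n → ℚ
    Q a b u v = weight u v * ((a u - a v) * (b u - b v))
    pointwise : ∀ s w xu xv yu yv →
      w * (((s * xu - yu) - (s * xv - yv)) * ((s * xu - yu) - (s * xv - yv))) ≡
      s * s * (w * ((xu - xv) * (xu - xv))) - (s + s) * (w * ((xu - xv) * (yu - yv))) + w * ((yu - yv) * (yu - yv))
    pointwise = solve-∀ ℚ-ring

  module _ {r} (regular : Regular G r) {i j} (ij : adj G i j ≡ true) where

    private
      i≢j : i ≢ j
      i≢j refl with () ← trans (sym ij) (irrefl G i)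

      y : Fin n → ℚ
      y = dipole i j

    dipole-source : y i ≡ 1ℚ
    dipole-source = cong₂ _-_ (unitVec-diag i) (unitVec-offDiag i≢j)

    dipole-sink : y j ≡ - 1ℚ
    dipole-sink = cong₂ _-_ (unitVec-offDiag (i≢j ∘ sym)) (unitVec-diag j)

    ⟨dipole,laplacian-dipole⟩ : ⟨ y , laplacian G y ⟩ ≡ (1ℚ + fromℕ r) + (1ℚ + fromℕ r)
    ⟨dipole,laplacian-dipole⟩ = begin
      ⟨ y , laplacian G y ⟩              ≡⟨ ⟨⟩-comm y (laplacian G y) ⟩
      ⟨ laplacian G y , y ⟩              ≡⟨ ⟨⟩-dipole (laplacian G y) i j ⟩
      laplacian G y i - laplacian G y j  ≡⟨ cong₂ _-_ (Ly i) (Ly j) ⟩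
      (fromℕ r * y i - (weight i i - weight i j)) - (fromℕ r * y j - (weight j i - weight j j))
        ≡⟨ cong₂ (λ p q → (fromℕ r * p - (weight i i - weight i j)) - (fromℕ r * q - (weight j i - weight j j)))
                 dipole-source dipole-sink ⟩
      (fromℕ r * 1ℚ - (weight i i - weight i j)) - (fromℕ r * - 1ℚ - (weight j i - weight j j))
        ≡⟨ cong₂ (λ p q → (fromℕ r * 1ℚ - p) - (fromℕ r * - 1ℚ - q))
                 (cong₂ (λ b c → 𝟙 b - 𝟙 c) (irrefl G i) ij)
                 (cong₂ (λ b c → 𝟙 b - 𝟙 c) (trans (Graph.sym G j i) ij) (irrefl G j)) ⟩
      (fromℕ r * 1ℚ - (0ℚ - 1ℚ)) - (fromℕ r * - 1ℚ - (1ℚ - 0ℚ))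
        ≡⟨ arith (fromℕ r) ⟩
      (1ℚ + fromℕ r) + (1ℚ + fromℕ r)    ∎
      where
      open ≡-Reasoning
      Ly : ∀ u → laplacian G y u ≡ fromℕ r * y u - (weight u i - weight u j)
      Ly u = trans (laplacian-degree y u)
                   (cong₂ (λ d p → fromℕ d * y u - p) (regular u) (⟨⟩-dipole (weight u) i j))
      arith : ∀ ρ → (ρ * 1ℚ - (0ℚ - 1ℚ)) - (ρ * - 1ℚ - (1ℚ - 0ℚ)) ≡ (1ℚ + ρ) + (1ℚ + ρ)
      arith = solve-∀ ℚ-ring

    -- Cauchy–Schwarz for D in division-free form: 0 ≤ D(s x − y, s x − y) with s = D(y,y)/D(x,y).
    resistance-lower-bound : ∀ x → (∀ k → laplacian G x k ≡ dipole i j k) →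
                             1ℚ + 1ℚ ≤ (1ℚ + fromℕ r) * (x i - x j)
    resistance-lower-bound x Lx≡y = *-cancelˡ-≤-pos (s + s) {{s+s-pos}} (begin
      (s + s) * (1ℚ + 1ℚ)
        ≡⟨ +-identityˡ _ ⟨
      0ℚ + (s + s) * (1ℚ + 1ℚ)
        ≤⟨ +-monoˡ-≤ ((s + s) * (1ℚ + 1ℚ)) (dirichlet-nonNeg z) ⟩
      dirichlet z z + (s + s) * (1ℚ + 1ℚ)
        ≡⟨ cong (_+ (s + s) * (1ℚ + 1ℚ)) (dirichlet-expand s x y) ⟩
      quadratic (dirichlet x x) (dirichlet x y) (dirichlet y y) + (s + s) * (1ℚ + 1ℚ)
        ≡⟨ cong₂ (λ d e → quadratic d e (dirichlet y y) + (s + s) * (1ℚ + 1ℚ)) Dxx Dxy ⟩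
      quadratic (ω + ω) (1ℚ + 1ℚ + (1ℚ + 1ℚ)) (dirichlet y y) + (s + s) * (1ℚ + 1ℚ)
        ≡⟨ cong (λ f → quadratic (ω + ω) (1ℚ + 1ℚ + (1ℚ + 1ℚ)) f + (s + s) * (1ℚ + 1ℚ)) Dyy ⟩
      quadratic (ω + ω) (1ℚ + 1ℚ + (1ℚ + 1ℚ)) (s + s + (s + s)) + (s + s) * (1ℚ + 1ℚ)
        ≡⟨ complete-square s ω ⟩
      (s + s) * (s * ω) ∎)
      where
      open ≤-Reasoning
      s ω : ℚ
      s = 1ℚ + fromℕ r
      ω = x i - x j
      z : Fin n → ℚ
      z u = s * x u - y u
      quadratic : ℚ → ℚ → ℚ → ℚ
      quadratic d e f = s * s * d - (s + s) * e + f
      s-pos : Positive s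
      s-pos = pos+nonNeg⇒pos 1ℚ (fromℕ r) {{nonNegative (fromℕ-nonNeg r)}}
      s+s-pos : Positive (s + s)
      s+s-pos = pos+pos⇒pos s {{s-pos}} s {{s-pos}}
      potential : ∀ a → ⟨ a , laplacian G x ⟩ ≡ a i - a j
      potential = ⟨⟩-laplacian-potential x Lx≡y
      Dxx : dirichlet x x ≡ ω + ω
      Dxx = trans (dirichlet-laplacian x x) (cong₂ _+_ (potential x) (potential x))
      Dxy : dirichlet x y ≡ 1ℚ + 1ℚ + (1ℚ + 1ℚ)
      Dxy = trans (dirichlet-comm x y) (trans (dirichlet-laplacian y x) (cong₂ _+_ ⟨y,Lx⟩ ⟨y,Lx⟩))
        where
        ⟨y,Lx⟩ : ⟨ y , laplacian G x ⟩ ≡ 1ℚ + 1ℚ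
        ⟨y,Lx⟩ = trans (potential y) (cong₂ _-_ dipole-source dipole-sink)
      Dyy : dirichlet y y ≡ s + s + (s + s)
      Dyy = trans (dirichlet-laplacian y y) (cong₂ _+_ ⟨dipole,laplacian-dipole⟩ ⟨dipole,laplacian-dipole⟩)
      complete-square : ∀ s ω →
        s * s * (ω + ω) - (s + s) * (1ℚ + 1ℚ + (1ℚ + 1ℚ)) + (s + s + (s + s)) + (s + s) * (1ℚ + 1ℚ) ≡
        (s + s) * (s * ω)
      complete-square = solve-∀ ℚ-ring

  edgeCount : ℚ
  edgeCount = ∑[ u < n ] ∑[ v < n ] (𝟙 (adj G u v ∧ (toℕ u ℕ.<ᵇ toℕ v)))

  handshake : edgeCount + edgeCount ≡ ∑[ u < n ] (fromℕ (degree G u))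
  handshake = begin
    edgeCount + edgeCount
      ≡⟨ cong (edgeCount +_) (∑-comm below) ⟩
    edgeCount + ∑[ u < n ] ∑[ v < n ] (below v u)
      ≡⟨ cong (edgeCount +_) (sum-cong-≗ (λ u → sum-cong-≗ (λ v →
           cong (λ b → 𝟙 (b ∧ (toℕ v ℕ.<ᵇ toℕ u))) (Graph.sym G v u)))) ⟩
    edgeCount + ∑[ u < n ] ∑[ v < n ] (above u v)
      ≡⟨ ∑-distrib-+ (sum ∘ below) (sum ∘ above) ⟨
    ∑[ u < n ] (sum (below u) + sum (above u))
      ≡⟨ sum-cong-≗ (λ u → ∑-distrib-+ (below u) (above u)) ⟨
    ∑[ u < n ] ∑[ v < n ] (below u v + above u v)
      ≡⟨ sum-cong-≗ (λ u → sum-cong-≗ (below+above u)) ⟩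
    ∑[ u < n ] ∑[ v < n ] (weight u v)
      ≡⟨ sum-cong-≗ ∑weight≡degree ⟩
    ∑[ u < n ] (fromℕ (degree G u)) ∎
    where
    open ≡-Reasoning
    below above : Fin n → Fin n → ℚ
    below u v = 𝟙 (adj G u v ∧ (toℕ u ℕ.<ᵇ toℕ v))
    above u v = 𝟙 (adj G u v ∧ (toℕ v ℕ.<ᵇ toℕ u))
    below+above : ∀ u v → below u v + above u v ≡ weight u v
    below+above u v with adj G u v in uv
    ... | false = refl
    ... | true  = 𝟙-<ᵇ-total (λ u≡v → loop (toℕ-injective u≡v))
      where
      loop : u ≢ v
      loop refl with () ← trans (sym uv) (irrefl G u)

  cyclicity≤edgeCount* : ∀ Ω h → (∀ u v → adj G u v ≡ true → inv (Ω u v) - 1ℚ ≤ h) →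
                         cyclicity G Ω ≤ edgeCount * h
  cyclicity≤edgeCount* Ω h edge≤h = begin
    cyclicity G Ω
      ≡⟨ trans (sumFin≡sum (sumFin ∘ term)) (sum-cong-≗ (sumFin≡sum ∘ term)) ⟩
    ∑[ u < n ] ∑[ v < n ] (term u v)
      ≤⟨ sum-mono-≤ (λ u → sum-mono-≤ (term≤ u)) ⟩
    ∑[ u < n ] ∑[ v < n ] (below u v * h)
      ≡⟨ sum-cong-≗ (λ u → *-distribʳ-sum h (below u)) ⟨
    ∑[ u < n ] (sum (below u) * h)
      ≡⟨ *-distribʳ-sum h (sum ∘ below) ⟨
    edgeCount * h ∎
    where
    open ≤-Reasoning
    below term : Fin n → Fin n → ℚ
    below u v = 𝟙 (adj G u v ∧ (toℕ u ℕ.<ᵇ toℕ v))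
    term u v = if adj G u v ∧ (toℕ u ℕ.<ᵇ toℕ v) then inv (Ω u v) - 1ℚ else 0ℚ
    term≤ : ∀ u v → term u v ≤ below u v * h
    term≤ u v with adj G u v in uv | toℕ u ℕ.<ᵇ toℕ v
    ... | false | _     = ≤-reflexive (sym (*-zeroˡ h))
    ... | true  | false = ≤-reflexive (sym (*-zeroˡ h))
    ... | true  | true  = subst (inv (Ω u v) - 1ℚ ≤_) (sym (*-identityˡ h)) (edge≤h u v uv)

mainTheorem10 : (n r : ℕ) (G : Graph n) → Connected G → Regular G r →
    (Ω : Fin n → Fin n → ℚ) → (∀ i j → IsEffRes G i j (Ω i j)) →
    cyclicity G Ω ≤ (ℤ.+ (n ℕ.* r ℕ.* (r ∸ 1))) / 4
mainTheorem10 n r G _ regular Ω effRes = begin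
  cyclicity G Ω                                    ≤⟨ cyclicity≤edgeCount* G Ω (fromℕ (r ∸ 1) * ½) edge-bound ⟩
  edgeCount G * (fromℕ (r ∸ 1) * ½)                ≡⟨ halve (edgeCount G) (fromℕ (r ∸ 1)) ⟩
  (edgeCount G + edgeCount G) * fromℕ (r ∸ 1) * ¼  ≡⟨ cong (λ e → e * fromℕ (r ∸ 1) * ¼)
                                                          (trans (handshake G) (∑degree-regular G regular)) ⟩
  fromℕ (n ℕ.* r) * fromℕ (r ∸ 1) * ¼              ≡⟨ cong (_* ¼) (×1-homo-* (n ℕ.* r) (r ∸ 1)) ⟨
  fromℕ (n ℕ.* r ℕ.* (r ∸ 1)) * ¼                  ≡⟨ /4≡fromℕ*¼ (n ℕ.* r ℕ.* (r ∸ 1)) ⟨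
  ℤ.+ (n ℕ.* r ℕ.* (r ∸ 1)) / 4                    ∎
  where
  open ≤-Reasoning
  ¼ : ℚ
  ¼ = ℤ.+ 1 / 4
  edge-bound : ∀ u v → adj G u v ≡ true → inv (Ω u v) - 1ℚ ≤ fromℕ (r ∸ 1) * ½
  edge-bound u v uv with effRes u v
  ... | x , Lx≡dipole , Ω≡ω = inv-1≤½[r∸1] r (Ω u v)
          (subst (λ ω → 1ℚ + 1ℚ ≤ (1ℚ + fromℕ r) * ω) (sym Ω≡ω)
                 (resistance-lower-bound G regular uv x Lx≡dipole))
  halve : ∀ e ρ → e * (ρ * ½) ≡ (e + e) * ρ * ¼
  halve = solve-∀ ℚ-ring
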